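{- The order-preserving logic $\vdash^{\leq}_{\mathbb{O}}$ of the variety $\mathbb{O}$ of Ockham algebras is not finitely based.
   Context: Fix the language with binary connectives $\land,\lor$, unary $\neg$ and constants $\bot,\top$; $Fm$ is the set of formulas over a countably infinite set of variables. A distributive lattice with negation is an algebra $\langle A;\land,\lor,\neg,\bot,\top\rangle$ whose reduct $\langle A;\land,\lor,\bot,\top\rangle$ is a bounded distributive lattice and which satisfies $\neg\bot\approx\top$ and $\neg(x\lor y)\approx\neg x\land\neg y$. An Ockham algebra is a distributive lattice with negation satisfying moreover $\neg\top\approx\bot$ and $\neg(x\land y)\approx\neg x\lor\neg y$; $\mathbb{O}$ is the variety of Ockham algebras. For a class $\mathbb{K}$ of distributive lattices with negation, the order-preserving logic $\vdash^{\leq}_{\mathbb{K}}$ is given by: $\Gamma\vdash^{\leq}_{\mathbb{K}}\varphi$ iff for every $\mathbf{A}\in\mathbb{K}$, every non-empty lattice filter $F$ of $\mathbf{A}$ and every homomorphism $h\colon Fm\to A$, $h[\Gamma]\subseteq F$ implies $h(\varphi)\in F$. A Hilbert rule schema is a pair $\frac{\Gamma}{\varphi}$ with $\Gamma$ a finite (possibly empty) set of formulas; a logic is finitely based if it is the derivability relation of Hilbert derivations (using substitution instances) for some finite set of rule schemata. -}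

module Defs where

open import Data.Nat using (ℕ)
open import Data.List using (List)
open import Data.List.Relation.Unary.All using (All)
open import Data.List.Membership.Propositional using (_∈_)
open import Data.Product using (Σ; ∃; _×_)
open import Relation.Binary.PropositionalEquality using (_≡_)
open import Level using (0ℓ)

data Fm : Set where
  var  : ℕ → Fm
  _∧̇_  : Fm → Fm → Fm
  _∨̇_  : Fm → Fm → Fm
  ¬̇_   : Fm → Fm
  ⊥̇ ⊤̇  : Fm

record OckhamAlgebra : Set₁ where
  field
    Carrier : Set
    _∧_ _∨_ : Carrier → Carrier → Carrier
    ¬_      : Carrier → Carrier
    ⊥ ⊤     : Carrier
    ∧-assoc : ∀ x y z → (x ∧ y) ∧ z ≡ x ∧ (y ∧ z)
    ∨-assoc : ∀ x y z → (x ∨ y) ∨ z ≡ x ∨ (y ∨ z)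
    ∧-comm  : ∀ x y → x ∧ y ≡ y ∧ x
    ∨-comm  : ∀ x y → x ∨ y ≡ y ∨ x
    ∧-absorbs-∨ : ∀ x y → x ∧ (x ∨ y) ≡ x
    ∨-absorbs-∧ : ∀ x y → x ∨ (x ∧ y) ≡ x
    ∧-distrib-∨ : ∀ x y z → x ∧ (y ∨ z) ≡ (x ∧ y) ∨ (x ∧ z)
    ⊥-identity : ∀ x → x ∨ ⊥ ≡ x
    ⊤-identity : ∀ x → x ∧ ⊤ ≡ x
    ¬⊥≡⊤   : ¬ ⊥ ≡ ⊤
    ¬-∨    : ∀ x y → ¬ (x ∨ y) ≡ (¬ x) ∧ (¬ y)
    ¬⊤≡⊥   : ¬ ⊤ ≡ ⊥
    ¬-∧    : ∀ x y → ¬ (x ∧ y) ≡ (¬ x) ∨ (¬ y)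

module _ (A : OckhamAlgebra) where
  open OckhamAlgebra A

  _≤_ : Carrier → Carrier → Set
  a ≤ b = a ∧ b ≡ a

  record IsFilter (F : Carrier → Set) : Set where
    field
      nonempty : ∃ F
      up-closed : ∀ {a b} → F a → a ≤ b → F b
      ∧-closed  : ∀ {a b} → F a → F b → F (a ∧ b)

  -- homomorphisms Fm → A are exactly extensions of valuations ℕ → A
  ⟦_⟧ : Fm → (ℕ → Carrier) → Carrier
  ⟦ var n ⟧ v = v n
  ⟦ φ ∧̇ ψ ⟧ v = ⟦ φ ⟧ v ∧ ⟦ ψ ⟧ v
  ⟦ φ ∨̇ ψ ⟧ v = ⟦ φ ⟧ v ∨ ⟦ ψ ⟧ v
  ⟦ ¬̇ φ ⟧ v = ¬ ⟦ φ ⟧ v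
  ⟦ ⊥̇ ⟧ v = ⊥
  ⟦ ⊤̇ ⟧ v = ⊤

FmSet : Set₁
FmSet = Fm → Set

_⊢≤O_ : FmSet → Fm → Set₁
Γ ⊢≤O φ = (A : OckhamAlgebra) (F : OckhamAlgebra.Carrier A → Set) → IsFilter A F →
          (v : ℕ → OckhamAlgebra.Carrier A) →
          (∀ γ → Γ γ → F (⟦ A ⟧ γ v)) → F (⟦ A ⟧ φ v)

Subst : Set
Subst = ℕ → Fm

_[_] : Fm → Subst → Fm
var n [ σ ] = σ n
(φ ∧̇ ψ) [ σ ] = (φ [ σ ]) ∧̇ (ψ [ σ ])
(φ ∨̇ ψ) [ σ ] = (φ [ σ ]) ∨̇ (ψ [ σ ])
(¬̇ φ) [ σ ] = ¬̇ (φ [ σ ])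
⊥̇ [ σ ] = ⊥̇
⊤̇ [ σ ] = ⊤̇

record Rule : Set where
  constructor _/_
  field
    premises   : List Fm
    conclusion : Fm

data Derivable (R : List Rule) (Γ : FmSet) : Fm → Set where
  assum : ∀ {φ} → Γ φ → Derivable R Γ φ
  apply : ∀ {Δ ψ} → (Δ / ψ) ∈ R → (σ : Subst) →
          All (λ δ → Derivable R Γ (δ [ σ ])) Δ →
          Derivable R Γ (ψ [ σ ])

FinitelyBased : (FmSet → Fm → Set₁) → Set₁
FinitelyBased L = Σ (List Rule) λ R →
  ∀ Γ φ → (Derivable R Γ φ → L Γ φ) × (L Γ φ → Derivable R Γ φ)

-- Let d bound the negation depth of the formulas of a finite set of rules.
-- In the matrix below, the truth of a formula of depth ≤ d at the designated
-- point pos (2d) depends only on pos 2d, …, pos d, where the matrix looks like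
-- the Ockham algebra of subsets of the chain Fin (2d+1) under pred. So every
-- Ockham-sound rule of depth ≤ d, and hence everything derivable from such
-- rules, is valid in the matrix. But at pos 0 negation is existential over two
-- successors, so ¬¬ does not preserve ∧ there, and the Ockham-valid rule
-- ¬¬^(d+1) p ∧ ¬¬^(d+1) q / ¬¬^(d+1) (p ∧ q), which reaches pos 0 from
-- pos 2d, fails.
module Submission where

open import Defs hiding (_≤_)
open import Relation.Nullary using (¬_)
open import Data.Bool using (Bool; true; false; not; _∧_; _∨_)
open import Data.Bool.Properties using (∨-∧-booleanAlgebra; not-involutive)
open import Algebra.Lattice.Properties.BooleanAlgebra ∨-∧-booleanAlgebra using (deMorgan₁; deMorgan₂)
open import Data.Fin using (Fin; suc; toℕ; fromℕ; pred; inject₁)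
open import Data.Fin.Properties using (toℕ-inject₁; toℕ-fromℕ)
open import Data.Fin.Subset using (Subset; _∩_; _∪_) renaming (⊥ to ∅; ⊤ to full)
open import Data.Fin.Subset.Properties using (∩-assoc; ∪-assoc; ∩-comm; ∪-comm; ∩-abs-∪; ∪-abs-∩; ∩-distribˡ-∪; ∪-identityʳ; ∩-identityʳ)
open import Data.List using (List; _∷_; map; concatMap)
open import Data.List.Extrema.Nat using (max; xs≤max)
open import Data.List.Membership.Propositional using (_∈_)
open import Data.List.Relation.Unary.All as All using (All; []; _∷_)
open import Data.List.Relation.Unary.All.Properties using (map⁻; concat⁻)
open import Data.Nat using (ℕ; zero; suc; _*_; _⊔_; _≤_; s≤s)
open import Data.Nat.Properties using (≤-trans; ≤-reflexive; m≤m*n; m⊔n≤o⇒m≤o; m⊔n≤o⇒n≤o)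
open import Data.Product using (_,_; proj₁; proj₂)
open import Data.Vec using (lookup; tabulate; replicate; zipWith)
open import Data.Vec.Properties using (lookup∘tabulate; tabulate-cong; tabulate∘lookup; lookup-zipWith; lookup-replicate)
open import Function using (_∘_)
open import Relation.Binary.PropositionalEquality using (_≡_; _≗_; refl; sym; trans; cong; cong₂; subst; module ≡-Reasoning)

open ≡-Reasoning

depth : Fm → ℕ
depth (var x)  = 0
depth (φ ∧̇ ψ) = depth φ ⊔ depth ψ
depth (φ ∨̇ ψ) = depth φ ⊔ depth ψ
depth (¬̇ φ)   = suc (depth φ)
depth ⊥̇       = 0
depth ⊤̇       = 0

¬¬^ : ℕ → Fm → Fm
¬¬^ zero    φ = φ
¬¬^ (suc j) φ = ¬̇ ¬̇ ¬¬^ j φ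

[var]-identity : ∀ φ → φ [ var ] ≡ φ
[var]-identity (var x)  = refl
[var]-identity (φ ∧̇ ψ) = cong₂ _∧̇_ ([var]-identity φ) ([var]-identity ψ)
[var]-identity (φ ∨̇ ψ) = cong₂ _∨̇_ ([var]-identity φ) ([var]-identity ψ)
[var]-identity (¬̇ φ)   = cong ¬̇_ ([var]-identity φ)
[var]-identity ⊥̇       = refl
[var]-identity ⊤̇       = refl

formulas : Rule → List Fm
formulas (Δ / ψ) = ψ ∷ Δ

depthBound : List Rule → ℕ
depthBound R = max 0 (map depth (concatMap formulas R))

depthBound-bounds : ∀ R → All (All (λ φ → depth φ ≤ depthBound R) ∘ formulas) R
depthBound-bounds R = map⁻ (concat⁻ (map⁻ (xs≤max 0 (map depth (concatMap formulas R)))))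

rule-derivable : ∀ {R Δ ψ} → (Δ / ψ) ∈ R → Derivable R (_∈ Δ) ψ
rule-derivable {Δ = Δ} {ψ} r = subst (Derivable _ _) ([var]-identity ψ)
  (apply r var (All.tabulate λ {δ} δ∈Δ → subst (Derivable _ _) (sym ([var]-identity δ)) (assum δ∈Δ)))

tabulate≗lookup⇒≡ : ∀ {A : Set} {n} {f : Fin n → A} xs → (∀ i → f i ≡ lookup xs i) → tabulate f ≡ xs
tabulate≗lookup⇒≡ xs f≗xs = trans (tabulate-cong f≗xs) (tabulate∘lookup xs)

module PowersetOckham {n : ℕ} (g : Fin n → Fin n) where

  ∼_ : Subset n → Subset n
  ∼ X = tabulate (λ i → not (lookup X (g i)))

  lookup-∼ : ∀ X i → lookup (∼ X) i ≡ not (lookup X (g i))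
  lookup-∼ X = lookup∘tabulate _

  ∼-replicate : ∀ b → ∼ replicate n b ≡ replicate n (not b)
  ∼-replicate b = tabulate≗lookup⇒≡ _ λ i →
    trans (cong not (lookup-replicate (g i) b)) (sym (lookup-replicate i (not b)))

  ∼-zipWith : ∀ f h → (∀ a b → not (f a b) ≡ h (not a) (not b)) →
              ∀ X Y → ∼ zipWith f X Y ≡ zipWith h (∼ X) (∼ Y)
  ∼-zipWith f h not-f X Y = tabulate≗lookup⇒≡ _ λ i → begin
    not (lookup (zipWith f X Y) (g i))                 ≡⟨ cong not (lookup-zipWith f (g i) X Y) ⟩
    not (f (lookup X (g i)) (lookup Y (g i)))          ≡⟨ not-f _ _ ⟩
    h (not (lookup X (g i))) (not (lookup Y (g i)))    ≡⟨ cong₂ h (lookup-∼ X i) (lookup-∼ Y i) ⟨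
    h (lookup (∼ X) i) (lookup (∼ Y) i)                ≡⟨ lookup-zipWith h i (∼ X) (∼ Y) ⟨
    lookup (zipWith h (∼ X) (∼ Y)) i                   ∎

  algebra : OckhamAlgebra
  algebra = record
    { Carrier     = Subset n
    ; _∧_         = _∩_
    ; _∨_         = _∪_
    ; ¬_          = ∼_
    ; ⊥           = ∅
    ; ⊤           = full
    ; ∧-assoc     = ∩-assoc
    ; ∨-assoc     = ∪-assoc
    ; ∧-comm      = ∩-comm
    ; ∨-comm      = ∪-comm
    ; ∧-absorbs-∨ = ∩-abs-∪
    ; ∨-absorbs-∧ = ∪-abs-∩
    ; ∧-distrib-∨ = ∩-distribˡ-∪
    ; ⊥-identity  = ∪-identityʳ
    ; ⊤-identity  = ∩-identityʳ
    ; ¬⊥≡⊤        = ∼-replicate false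
    ; ¬-∨         = ∼-zipWith _∨_ _∧_ deMorgan₂
    ; ¬⊤≡⊥        = ∼-replicate true
    ; ¬-∧         = ∼-zipWith _∧_ _∨_ deMorgan₁
    }

  point-isFilter : (p : Fin n) → IsFilter algebra (λ X → lookup X p ≡ true)
  point-isFilter p = record
    { nonempty  = full , lookup-replicate p true
    ; up-closed = λ {a} {b} a∋p a⊆b → begin
        lookup b p                  ≡⟨ cong (_∧ lookup b p) a∋p ⟨
        lookup a p ∧ lookup b p     ≡⟨ lookup-zipWith _∧_ p a b ⟨
        lookup (a ∩ b) p            ≡⟨ cong (λ X → lookup X p) a⊆b ⟩
        lookup a p                  ≡⟨ a∋p ⟩
        true                        ∎
    ; ∧-closed  = λ {a} {b} a∋p b∋p → trans (lookup-zipWith _∧_ p a b) (cong₂ _∧_ a∋p b∋p)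
    }

chainAlgebra : ℕ → OckhamAlgebra
chainAlgebra n = PowersetOckham.algebra (pred {n})

-- The matrix lives on the frame  … → pos 2 → pos 1 → pos 0 ⇉ leaf false, leaf true
-- (each leaf its own successor), with negation "some successor lies outside".
-- Above pos 0 every point has a single successor, as in the chain Fin n under pred.
data Node : Set where
  pos  : ℕ → Node
  leaf : Bool → Node

∼ₘ : (Node → Bool) → Node → Bool
∼ₘ X (pos zero)    = not (X (leaf false)) ∨ not (X (leaf true))
∼ₘ X (pos (suc k)) = not (X (pos k))
∼ₘ X (leaf b)      = not (X (leaf b))

∼ₘ-cong : ∀ {X Y} → X ≗ Y → ∼ₘ X ≗ ∼ₘ Y
∼ₘ-cong X≗Y (pos zero)    = cong₂ (λ a b → not a ∨ not b) (X≗Y (leaf false)) (X≗Y (leaf true))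
∼ₘ-cong X≗Y (pos (suc k)) = cong not (X≗Y (pos k))
∼ₘ-cong X≗Y (leaf b)      = cong not (X≗Y (leaf b))

⟪_⟫ : Fm → (ℕ → Node → Bool) → Node → Bool
⟪ var x ⟫  v   = v x
⟪ φ ∧̇ ψ ⟫ v s = ⟪ φ ⟫ v s ∧ ⟪ ψ ⟫ v s
⟪ φ ∨̇ ψ ⟫ v s = ⟪ φ ⟫ v s ∨ ⟪ ψ ⟫ v s
⟪ ¬̇ φ ⟫   v   = ∼ₘ (⟪ φ ⟫ v)
⟪ ⊥̇ ⟫     v _ = false
⟪ ⊤̇ ⟫     v _ = true

⟪⟫-[] : ∀ φ σ v → ⟪ φ [ σ ] ⟫ v ≗ ⟪ φ ⟫ (λ x → ⟪ σ x ⟫ v)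
⟪⟫-[] (var x)  σ v s = refl
⟪⟫-[] (φ ∧̇ ψ) σ v s = cong₂ _∧_ (⟪⟫-[] φ σ v s) (⟪⟫-[] ψ σ v s)
⟪⟫-[] (φ ∨̇ ψ) σ v s = cong₂ _∨_ (⟪⟫-[] φ σ v s) (⟪⟫-[] ψ σ v s)
⟪⟫-[] (¬̇ φ)   σ v s = ∼ₘ-cong (⟪⟫-[] φ σ v) s
⟪⟫-[] ⊥̇       σ v s = refl
⟪⟫-[] ⊤̇       σ v s = refl

restrict : ∀ n → (ℕ → Node → Bool) → ℕ → Subset n
restrict n v x = tabulate (λ i → v x (pos (toℕ i)))

chainEval : ∀ n → Fm → (ℕ → Node → Bool) → Subset n
chainEval n φ v = ⟦ chainAlgebra n ⟧ φ (restrict n v)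

chain-agrees : ∀ {n} φ v (i : Fin n) → depth φ ≤ toℕ i → lookup (chainEval n φ v) i ≡ ⟪ φ ⟫ v (pos (toℕ i))
chain-agrees (var x)  v i _ = lookup∘tabulate _ i
chain-agrees {n} (φ ∧̇ ψ) v i φψ≤i = trans (lookup-zipWith _∧_ i (chainEval n φ v) (chainEval n ψ v))
  (cong₂ _∧_ (chain-agrees φ v i (m⊔n≤o⇒m≤o _ _ φψ≤i)) (chain-agrees ψ v i (m⊔n≤o⇒n≤o _ _ φψ≤i)))
chain-agrees {n} (φ ∨̇ ψ) v i φψ≤i = trans (lookup-zipWith _∨_ i (chainEval n φ v) (chainEval n ψ v))
  (cong₂ _∨_ (chain-agrees φ v i (m⊔n≤o⇒m≤o _ _ φψ≤i)) (chain-agrees ψ v i (m⊔n≤o⇒n≤o _ _ φψ≤i)))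
chain-agrees {suc n} (¬̇ φ) v (suc j) (s≤s φ≤j) = begin
  lookup (∼ chainEval (suc n) φ v) (suc j)         ≡⟨ lookup-∼ (chainEval (suc n) φ v) (suc j) ⟩
  not (lookup (chainEval (suc n) φ v) (inject₁ j)) ≡⟨ cong not (chain-agrees φ v (inject₁ j) φ≤j′) ⟩
  not (⟪ φ ⟫ v (pos (toℕ (inject₁ j))))            ≡⟨ cong (λ k → not (⟪ φ ⟫ v (pos k))) (toℕ-inject₁ j) ⟩
  not (⟪ φ ⟫ v (pos (toℕ j)))                      ∎
  where
    open PowersetOckham (pred {suc n}) using (∼_; lookup-∼)
    φ≤j′ : depth φ ≤ toℕ (inject₁ j)
    φ≤j′ = ≤-trans φ≤j (≤-reflexive (sym (toℕ-inject₁ j)))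
chain-agrees ⊥̇ v i _ = lookup-replicate i false
chain-agrees ⊤̇ v i _ = lookup-replicate i true

chain-agrees-top : ∀ {m} φ v → depth φ ≤ m → lookup (chainEval (suc m) φ v) (fromℕ m) ≡ ⟪ φ ⟫ v (pos m)
chain-agrees-top {m} φ v with chain-agrees φ v (fromℕ m)
... | agrees rewrite toℕ-fromℕ m = agrees

Holds : ℕ → (ℕ → Node → Bool) → Fm → Set
Holds m v φ = ⟪ φ ⟫ v (pos m) ≡ true

MatrixValid : ℕ → List Fm → Fm → Set
MatrixValid m Δ ψ = ∀ v → All (Holds m v) Δ → Holds m v ψ

⊢≤O⇒matrixValid : ∀ {m Δ ψ} → All (λ φ → depth φ ≤ m) (ψ ∷ Δ) → (_∈ Δ) ⊢≤O ψ → MatrixValid m Δ ψ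
⊢≤O⇒matrixValid {m} {Δ} {ψ} (ψ≤m ∷ Δ≤m) Δ⊢ψ v Δ-holds = begin
  ⟪ ψ ⟫ v (pos m)                     ≡⟨ chain-agrees-top ψ v ψ≤m ⟨
  lookup (⟦ A ⟧ ψ w) (fromℕ m)        ≡⟨ Δ⊢ψ A _ (point-isFilter (fromℕ m)) w Δ-in-filter ⟩
  true                                 ∎
  where
    open PowersetOckham (pred {suc m}) using (point-isFilter)
    A : OckhamAlgebra
    A = chainAlgebra (suc m)
    w : ℕ → Subset (suc m)
    w = restrict (suc m) v
    Δ-in-filter : ∀ δ → δ ∈ Δ → lookup (⟦ A ⟧ δ w) (fromℕ m) ≡ true
    Δ-in-filter δ δ∈Δ = trans (chain-agrees-top δ v (All.lookup Δ≤m δ∈Δ)) (All.lookup Δ-holds δ∈Δ)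

module _ {R : List Rule} {m : ℕ} (R-valid : ∀ {Δ ψ} → (Δ / ψ) ∈ R → MatrixValid m Δ ψ) where

  derivable⇒holds : ∀ {Γ φ} v → (∀ {γ} → Γ γ → Holds m v γ) → Derivable R Γ φ → Holds m v φ
  premises-hold : ∀ {Γ Δ} v → (∀ {γ} → Γ γ → Holds m v γ) → (σ : Subst) →
                  All (λ δ → Derivable R Γ (δ [ σ ])) Δ → All (Holds m (λ x → ⟪ σ x ⟫ v)) Δ

  derivable⇒holds v Γ-holds (assum γ) = Γ-holds γ
  derivable⇒holds v Γ-holds (apply {ψ = ψ} r σ ds) =
    trans (⟪⟫-[] ψ σ v (pos m)) (R-valid r _ (premises-hold v Γ-holds σ ds))

  premises-hold v Γ-holds σ [] = []
  premises-hold {Δ = δ ∷ _} v Γ-holds σ (d ∷ ds) =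
    trans (sym (⟪⟫-[] δ σ v (pos m))) (derivable⇒holds v Γ-holds d) ∷ premises-hold v Γ-holds σ ds

module _ (A : OckhamAlgebra) where
  open OckhamAlgebra A using (¬-∧; ¬-∨) renaming (_∧_ to _∧ᴬ_; _∨_ to _∨ᴬ_; ¬_ to ∼_)

  ⟦¬¬^⟧-∧ : ∀ j φ ψ v → ⟦ A ⟧ (¬¬^ j (φ ∧̇ ψ)) v ≡ ⟦ A ⟧ (¬¬^ j φ ∧̇ ¬¬^ j ψ) v
  ⟦¬¬^⟧-∧ zero    φ ψ v = refl
  ⟦¬¬^⟧-∧ (suc j) φ ψ v = begin
    ∼ (∼ ⟦ A ⟧ (¬¬^ j (φ ∧̇ ψ)) v) ≡⟨ cong (λ c → ∼ (∼ c)) (⟦¬¬^⟧-∧ j φ ψ v) ⟩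
    ∼ (∼ (a ∧ᴬ b))                 ≡⟨ cong ∼_ (¬-∧ a b) ⟩
    ∼ ((∼ a) ∨ᴬ (∼ b))             ≡⟨ ¬-∨ (∼ a) (∼ b) ⟩
    (∼ (∼ a)) ∧ᴬ (∼ (∼ b))         ∎
    where
      a b : OckhamAlgebra.Carrier A
      a = ⟦ A ⟧ (¬¬^ j φ) v
      b = ⟦ A ⟧ (¬¬^ j ψ) v

¬¬^-∧-valid : ∀ j φ ψ → (_≡ ¬¬^ j φ ∧̇ ¬¬^ j ψ) ⊢≤O ¬¬^ j (φ ∧̇ ψ)
¬¬^-∧-valid j φ ψ A F _ v premise∈F = subst F (sym (⟦¬¬^⟧-∧ A j φ ψ v)) (premise∈F _ refl)

¬¬^-descends : ∀ j χ v → ⟪ ¬¬^ (suc j) χ ⟫ v (pos (j * 2)) ≡ ⟪ ¬̇ ¬̇ χ ⟫ v (pos 0)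
¬¬^-descends zero    χ v = refl
¬¬^-descends (suc j) χ v = trans (not-involutive _) (¬¬^-descends j χ v)

v₀ : ℕ → Node → Bool
v₀ 0 (leaf false) = true
v₀ 1 (leaf true)  = true
v₀ _ _            = false

¬¬^-premise-holds : ∀ j → Holds (j * 2) v₀ (¬¬^ (suc j) (var 0) ∧̇ ¬¬^ (suc j) (var 1))
¬¬^-premise-holds j = cong₂ _∧_ (¬¬^-descends j (var 0) v₀) (¬¬^-descends j (var 1) v₀)

¬¬^-conclusion-fails : ∀ j → ¬ Holds (j * 2) v₀ (¬¬^ (suc j) (var 0 ∧̇ var 1))
¬¬^-conclusion-fails j holds with trans (sym (¬¬^-descends j (var 0 ∧̇ var 1) v₀)) holds
... | ()

mainTheorem2 : ¬ FinitelyBased _⊢≤O_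
mainTheorem2 (R , basis) =
  ¬¬^-conclusion-fails d (derivable⇒holds R-valid v₀ (λ { refl → ¬¬^-premise-holds d }) derivation)
  where
    d : ℕ
    d = depthBound R
    R-valid : ∀ {Δ ψ} → (Δ / ψ) ∈ R → MatrixValid (d * 2) Δ ψ
    R-valid {Δ} {ψ} r = ⊢≤O⇒matrixValid
      (All.map (λ φ≤d → ≤-trans φ≤d (m≤m*n d 2)) (All.lookup (depthBound-bounds R) r))
      (proj₁ (basis (_∈ Δ) ψ) (rule-derivable r))
    derivation : Derivable R (_≡ ¬¬^ (suc d) (var 0) ∧̇ ¬¬^ (suc d) (var 1)) (¬¬^ (suc d) (var 0 ∧̇ var 1))
    derivation = proj₂ (basis _ _) (¬¬^-∧-valid (suc d) (var 0) (var 1))
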